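{- No infinite connected graph $G$ has an $\mathcal{F}$-root, i.e., there is no graph $H$ with $\mathcal{F}(H)\cong G$.
   Context: All graphs are simple (no loops or multiple edges), labeled, and may be infinite. A forest of $H$ is an acyclic subgraph; a maximal forest is a forest of $H$ not properly contained in another forest of $H$. The forest graph $\mathcal{F}(H)$ has as vertices the maximal forests of $H$, two being adjacent iff $F_2=F_1-e+f$ for some edges $e\in F_1$, $f\notin F_1$. -}

module Defs where

open import Level using (0ℓ)
open import Data.Nat using (ℕ; suc)
open import Data.Fin using (Fin; zero; suc; inject₁; fromℕ)
open import Data.List using (List)
open import Data.List.Membership.Propositional using (_∈_)
open import Data.Product using (Σ; _×_; _,_; ∃-syntax)
open import Data.Sum using (_⊎_)
open import Relation.Nullary using (¬_)
open import Relation.Binary.PropositionalEquality using (_≡_)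
open import Function.Bundles using (_⇔_)
open import Function.Definitions using (Injective)

record Graph : Set₁ where
  field
    V     : Set
    _~_   : V → V → Set
    sym   : ∀ {u v} → u ~ v → v ~ u
    irrefl : ∀ {u} → ¬ (u ~ u)

open Graph public

EdgeSet : Graph → Set₁
EdgeSet H = V H → V H → Set

IsSubgraph : (H : Graph) → EdgeSet H → Set
IsSubgraph H S = (∀ u v → S u v → _~_ H u v) × (∀ u v → S u v → S v u)

_⊆ₑ_ : {H : Graph} → EdgeSet H → EdgeSet H → Set
_⊆ₑ_ {H} S T = ∀ u v → S u v → T u v

-- A cycle in S: k+3 pairwise distinct vertices c 0, …, c (k+2) with
-- c i — c (i+1) in S and c (k+2) — c 0 in S.
HasCycle : (H : Graph) → EdgeSet H → Set
HasCycle H S =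
  Σ ℕ λ k → Σ (Fin (suc (suc (suc k))) → V H) λ c →
    Injective _≡_ _≡_ c
    × (∀ (i : Fin (suc (suc k))) → S (c (inject₁ i)) (c (suc i)))
    × S (c (fromℕ (suc (suc k)))) (c zero)

IsForest : (H : Graph) → EdgeSet H → Set
IsForest H S = IsSubgraph H S × ¬ HasCycle H S

IsMaximalForest : (H : Graph) → EdgeSet H → Set₁
IsMaximalForest H F =
  IsForest H F × (∀ (F' : EdgeSet H) → IsForest H F' → _⊆ₑ_ {H} F F' → _⊆ₑ_ {H} F' F)

MaximalForest : Graph → Set₁
MaximalForest H = Σ (EdgeSet H) (IsMaximalForest H)

_≈F_ : {H : Graph} → MaximalForest H → MaximalForest H → Set
_≈F_ {H} (F , _) (F' , _) = ∀ u v → F u v ⇔ F' u v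

SameEdge : {A : Set} → A → A → A → A → Set
SameEdge a b u v = (a ≡ u × b ≡ v) ⊎ (a ≡ v × b ≡ u)

-- adjacency in the forest graph 𝓕(H): F₂ = F₁ - e + f with e ∈ F₁, f ∉ F₁
-- (f an edge of H).
ForestAdj : (H : Graph) → MaximalForest H → MaximalForest H → Set
ForestAdj H (F₁ , _) (F₂ , _) =
  ∃[ u ] ∃[ v ] ∃[ x ] ∃[ y ]
    F₁ u v × _~_ H x y × ¬ F₁ x y
    × (∀ a b → F₂ a b ⇔ ((F₁ a b × ¬ SameEdge a b u v) ⊎ SameEdge a b x y))

-- An isomorphism 𝓕(H) ≅ G. The vertices of 𝓕(H) are maximal forests
-- taken up to equality of edge sets (_≈F_).
record ForestGraphIso (H G : Graph) : Set₁ where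
  field
    to        : MaximalForest H → V G
    from      : V G → MaximalForest H
    to-cong   : ∀ {F F'} → _≈F_ {H} F F' → to F ≡ to F'
    from-to   : ∀ F → _≈F_ {H} (from (to F)) F
    to-from   : ∀ v → to (from v) ≡ v
    adj       : ∀ F F' → ForestAdj H F F' ⇔ _~_ G (to F) (to F')

IsInfinite : Graph → Set
IsInfinite G = ¬ (Σ (List (V G)) λ xs → ∀ v → v ∈ xs)

data Reachable (G : Graph) : V G → V G → Set where
  here  : ∀ {u} → Reachable G u u
  there : ∀ {u v w} → _~_ G u v → Reachable G v w → Reachable G u w

IsConnected : Graph → Set
IsConnected G = ∀ u v → Reachable G u v

module Submission where

-- Adjacent maximal forests differ in two edges,
-- so by connectedness every maximal forest differs from a fixed one, F₀, in only finitely many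
-- edges. We build a maximal forest differing from F₀ in infinitely many edges. Starting from F₀,
-- we repeatedly exchange an edge xy of H for an edge ab of the current forest separating x from y,
-- while freezing a growing finite edge set U (containing ab, xy and the new a–b path) that later
-- exchanges never touch. A suitable xy always exists: otherwise the current forest restricted to U
-- would connect the endpoints of every edge of H, which forces all maximal forests to agree outside
-- the pairs of vertices of U, making G finite. The eventually stable edges form a maximal forest
-- containing all the (pairwise distinct) edges xy, none of which lies in F₀.

open import Defs

module _ where
  open import Level using (Lift; lift; 0ℓ) renaming (suc to lsuc)
  open import Data.Nat using (ℕ; zero; suc; _≤_; _<_; _≤′_; ≤′-refl; ≤′-step; _⊔_; z≤n; s≤s)
  open import Data.Nat.Properties using (≤-refl; ≤-trans; m≤m⊔n; m≤n⊔m; ≤⇒≤′; n<1+n)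
  open import Data.Fin using (Fin; inject₁; fromℕ; toℕ) renaming (zero to fzero; suc to fsuc)
  open import Data.Fin.Properties using (fromℕ≢inject₁; pigeonhole)
  open import Data.Bool using (Bool; true; false)
  open import Data.List using (List; []; _∷_; map; _++_; length; lookup; cartesianProduct)
  open import Data.List.Membership.Propositional using (_∈_; _∉_)
  open import Data.List.Membership.Propositional.Properties using (∈-map⁺; ∈-++⁺ˡ; ∈-++⁺ʳ; ∈-cartesianProduct⁺)
  open import Data.List.Relation.Unary.Any using (Any; here; there; index)
  open import Data.List.Relation.Unary.Any.Properties using (lookup-result; ++⁺ˡ; ++⁺ʳ; ++⁻)
  import Data.List.Relation.Unary.Any as Any
  open import Data.Vec using (Vec; []; _∷_; tabulate)
  import Data.Vec as Vec
  open import Data.Vec.Properties using (lookup∘tabulate)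
  open import Data.Product using (Σ; _×_; _,_; proj₁; proj₂; ∃-syntax)
  open import Data.Sum using (_⊎_; inj₁; inj₂)
  open import Data.Empty using (⊥-elim)
  open import Relation.Nullary using (¬_; Dec; yes; no; does)
  open import Relation.Binary.Core using (Rel; _⇒_)
  open import Relation.Binary.Definitions using (Symmetric)
  open import Relation.Binary.PropositionalEquality
    using (_≡_; refl; cong; subst; subst₂; module ≡-Reasoning) renaming (sym to ≡-sym; trans to ≡-trans)
  open import Relation.Binary.Construct.Closure.ReflexiveTransitive
    using (Star; ε; _◅_; _◅◅_; _⋆; reverse) renaming (map to mapStar)
  open import Function.Bundles using (_⇔_; mk⇔; Equivalence)
  open import Function.Properties.Equivalence using () renaming (refl to ⇔-refl; sym to ⇔-sym; trans to ⇔-trans)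
  open import Axiom.ExcludedMiddle using (ExcludedMiddle)
  open import Function.Definitions using (Injective)

  open Equivalence using (to; from)

  module _ {A : Set} where

    SameEdge-refl : ∀ {a b : A} → SameEdge a b a b
    SameEdge-refl = inj₁ (refl , refl)

    SameEdge-swap : ∀ {a b u v : A} → SameEdge a b u v → SameEdge b a u v
    SameEdge-swap (inj₁ (refl , refl)) = inj₂ (refl , refl)
    SameEdge-swap (inj₂ (refl , refl)) = inj₁ (refl , refl)

    SameEdge-sym : ∀ {a b u v : A} → SameEdge a b u v → SameEdge u v a b
    SameEdge-sym (inj₁ (refl , refl)) = inj₁ (refl , refl)
    SameEdge-sym (inj₂ (refl , refl)) = inj₂ (refl , refl)

    SameEdge-trans : ∀ {a b u v p q : A} → SameEdge a b u v → SameEdge u v p q → SameEdge a b p q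
    SameEdge-trans (inj₁ (refl , refl)) s = s
    SameEdge-trans (inj₂ (refl , refl)) s = SameEdge-swap s

    SameEdge-resp : ∀ {S : Rel A 0ℓ} {a b u v} → Symmetric S → SameEdge a b u v → S u v → S a b
    SameEdge-resp sym (inj₁ (refl , refl)) s = s
    SameEdge-resp sym (inj₂ (refl , refl)) s = sym s


  Star-sym : {A : Set} {S : Rel A 0ℓ} → Symmetric S → Symmetric (Star S)
  Star-sym sym = reverse sym

  module _ {V : Set} where

    record _∖[_,_] (S : Rel V 0ℓ) (a b u v : V) : Set where
      constructor keep
      field
        kept  : S u v
        other : ¬ SameEdge u v a b

    data _∪[_,_] (S : Rel V 0ℓ) (x y u v : V) : Set where
      old : S u v → (S ∪[ x , y ]) u v
      new : SameEdge u v x y → (S ∪[ x , y ]) u v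

    open _∖[_,_] public using (kept)

    module _ {S : Rel V 0ℓ} (sym : Symmetric S) where

      ∖-sym : ∀ {a b} → Symmetric (S ∖[ a , b ])
      ∖-sym (keep s n) = keep (sym s) (λ e → n (SameEdge-swap e))

      ∪-sym : ∀ {x y} → Symmetric (S ∪[ x , y ])
      ∪-sym (old s) = old (sym s)
      ∪-sym (new e) = new (SameEdge-swap e)

      ∖∪-restore : ∀ {a b} → S a b → (S ∖[ a , b ]) ∪[ a , b ] ⇒ S
      ∖∪-restore _  (old (keep s _)) = s
      ∖∪-restore ab (new e)         = SameEdge-resp sym e ab

      Star-∪-split : ∀ {x y p q} → Star (S ∪[ x , y ]) p q →
        Star S p q ⊎ (Star S p x × Star S y q) ⊎ (Star S p y × Star S x q)
      Star-∪-split ε = inj₁ ε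
      Star-∪-split (old s ◅ w) with Star-∪-split w
      ... | inj₁ w′               = inj₁ (s ◅ w′)
      ... | inj₂ (inj₁ (w₁ , w₂)) = inj₂ (inj₁ (s ◅ w₁ , w₂))
      ... | inj₂ (inj₂ (w₁ , w₂)) = inj₂ (inj₂ (s ◅ w₁ , w₂))
      Star-∪-split (new (inj₁ (refl , refl)) ◅ w) with Star-∪-split w
      ... | inj₁ w′               = inj₂ (inj₁ (ε , w′))
      ... | inj₂ (inj₁ (_ , w₂))  = inj₂ (inj₁ (ε , w₂))
      ... | inj₂ (inj₂ (_ , w₂))  = inj₁ w₂
      Star-∪-split (new (inj₂ (refl , refl)) ◅ w) with Star-∪-split w
      ... | inj₁ w′               = inj₂ (inj₂ (ε , w′))
      ... | inj₂ (inj₁ (_ , w₂))  = inj₁ w₂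
      ... | inj₂ (inj₂ (_ , w₂))  = inj₂ (inj₂ (ε , w₂))

      -- If adding xy connects p to q, the p–q walk must cross xy, so adding pq instead connects x to y.
      connects-∪-swap : ∀ {x y p q} → Star (S ∪[ x , y ]) p q → ¬ Star S p q → Star (S ∪[ p , q ]) x y
      connects-∪-swap w ¬pq with Star-∪-split w
      ... | inj₁ w′ = ⊥-elim (¬pq w′)
      ... | inj₂ (inj₁ (px , yq)) =
        mapStar old (Star-sym sym px) ◅◅ new SameEdge-refl ◅ mapStar old (Star-sym sym yq)
      ... | inj₂ (inj₂ (py , xq)) =
        mapStar old xq ◅◅ new (inj₂ (refl , refl)) ◅ mapStar old py

    ∪∖⊆∖∪ : ∀ {S : Rel V 0ℓ} {x y p q} → (S ∪[ x , y ]) ∖[ p , q ] ⇒ (S ∖[ p , q ]) ∪[ x , y ]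
    ∪∖⊆∖∪ (keep (old s) n) = old (keep s n)
    ∪∖⊆∖∪ (keep (new e) _) = new e

    AllBridges : Rel V 0ℓ → Set
    AllBridges S = ∀ {a b} → S a b → ¬ Star (S ∖[ a , b ]) a b

    AllBridges-⊆ : ∀ {S T : Rel V 0ℓ} → T ⇒ S → AllBridges S → AllBridges T
    AllBridges-⊆ T⊆S bridges t w = bridges (T⊆S t) (mapStar (λ (keep t′ n) → keep (T⊆S t′) n) w)

    _∈ₑ_ : V × V → List (V × V) → Set
    (a , b) ∈ₑ U = Any (λ e → SameEdge a b (proj₁ e) (proj₂ e)) U

    ∈ₑ-resp : ∀ {a b u v U} → SameEdge a b u v → (u , v) ∈ₑ U → (a , b) ∈ₑ U
    ∈ₑ-resp e = Any.map (SameEdge-trans e)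

    ∈ₑ-swap : ∀ {a b U} → (a , b) ∈ₑ U → (b , a) ∈ₑ U
    ∈ₑ-swap = ∈ₑ-resp (inj₂ (refl , refl))

    AgreeOutside : List (V × V) → Rel V 0ℓ → Rel V 0ℓ → Set
    AgreeOutside L S T = ∀ {a b} → ¬ (a , b) ∈ₑ L → S a b ⇔ T a b

    _↾_ : Rel V 0ℓ → List (V × V) → Rel V 0ℓ
    (S ↾ U) u v = S u v × (u , v) ∈ₑ U

    ↾-sym : ∀ {S : Rel V 0ℓ} → Symmetric S → ∀ {U} → Symmetric (S ↾ U)
    ↾-sym sym (s , i) = sym s , ∈ₑ-swap i

    edgesOf : ∀ {S : Rel V 0ℓ} {p q} → Star S p q → List (V × V)
    edgesOf ε = []
    edgesOf (_◅_ {u} {v} _ w) = (u , v) ∷ edgesOf w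

    Star-↾-edgesOf : ∀ {S : Rel V 0ℓ} {p q} (w : Star S p q) → Star (S ↾ edgesOf w) p q
    Star-↾-edgesOf ε = ε
    Star-↾-edgesOf (s ◅ w) =
      (s , here SameEdge-refl) ◅ mapStar (λ (s′ , i) → s′ , there i) (Star-↾-edgesOf w)

    ∈-edgesOf : ∀ {S : Rel V 0ℓ} → Symmetric S → ∀ {p q u v} (w : Star S p q) →
      (u , v) ∈ₑ edgesOf w → S u v
    ∈-edgesOf sym (s ◅ w) (here e)  = SameEdge-resp sym e s
    ∈-edgesOf sym (s ◅ w) (there i) = ∈-edgesOf sym w i

    endpoints : List (V × V) → List V
    endpoints [] = []
    endpoints ((u , v) ∷ U) = u ∷ v ∷ endpoints U

    pairsOn : List (V × V) → List (V × V)
    pairsOn U = cartesianProduct (endpoints U) (endpoints U)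

    ∈ₑ⇒∈endpoints : ∀ {a b} U → (a , b) ∈ₑ U → a ∈ endpoints U
    ∈ₑ⇒∈endpoints (_ ∷ U) (here (inj₁ (refl , _))) = here refl
    ∈ₑ⇒∈endpoints (_ ∷ U) (here (inj₂ (refl , _))) = there (here refl)
    ∈ₑ⇒∈endpoints (_ ∷ U) (there i)                = there (there (∈ₑ⇒∈endpoints U i))

    ∈endpoints⇒∈ₑpairsOn : ∀ {a b U} → a ∈ endpoints U → b ∈ endpoints U → (a , b) ∈ₑ pairsOn U
    ∈endpoints⇒∈ₑpairsOn a∈ b∈ = Any.map (λ { refl → SameEdge-refl }) (∈-cartesianProduct⁺ a∈ b∈)

    ∈ₑ⇒∈ₑpairsOn : ∀ {a b} U → (a , b) ∈ₑ U → (a , b) ∈ₑ pairsOn U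
    ∈ₑ⇒∈ₑpairsOn U i = ∈endpoints⇒∈ₑpairsOn (∈ₑ⇒∈endpoints U i) (∈ₑ⇒∈endpoints U (∈ₑ-swap i))

    Star-↾⇒∈endpoints : ∀ {S : Rel V 0ℓ} {U a b} → Star (S ↾ U) a b → ¬ a ≡ b → a ∈ endpoints U
    Star-↾⇒∈endpoints ε a≢b = ⊥-elim (a≢b refl)
    Star-↾⇒∈endpoints {U = U} ((_ , i) ◅ _) _ = ∈ₑ⇒∈endpoints U i

    distinctEdges-∉-finite : (x y : ℕ → V) → (∀ {n m} → n < m → ¬ SameEdge (x m) (y m) (x n) (y n)) →
      ∀ L → ¬ (∀ n → (x n , y n) ∈ₑ L)
    distinctEdges-∉-finite x y distinct L ∈L
      with i , j , i<j , same ← pigeonhole (n<1+n (length L)) (λ i → index (∈L (toℕ i))) =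
      distinct i<j (SameEdge-trans (lookup-result (∈L (toℕ j))) (SameEdge-sym
        (subst (λ e → SameEdge (x (toℕ i)) (y (toℕ i)) (proj₁ e) (proj₂ e)) (cong (lookup L) same)
          (lookup-result (∈L (toℕ i))))))

    mutual
      data Path (T : Rel V 0ℓ) : V → V → Set where
        nil  : ∀ {u} → Path T u u
        cons : ∀ {u v w} → T u v → (p : Path T v w) → u ∉ vertices p → Path T u w

      vertices : ∀ {T u w} → Path T u w → List V
      vertices {u = u} nil = u ∷ []
      vertices (cons {u} _ p _) = u ∷ vertices p

    module _ {T : Rel V 0ℓ} where

      start∈vertices : ∀ {u w} (p : Path T u w) → u ∈ vertices p
      start∈vertices nil = here refl
      start∈vertices (cons _ _ _) = here refl

      Path-∖ : ∀ {u w x z} (p : Path T u w) → x ∉ vertices p → Star (T ∖[ x , z ]) u w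
      Path-∖ nil _ = ε
      Path-∖ (cons t p _) x∉ = keep t avoid ◅ Path-∖ p (λ x∈ → x∉ (there x∈))
        where
        avoid : ¬ SameEdge _ _ _ _
        avoid (inj₁ (refl , _)) = x∉ (here refl)
        avoid (inj₂ (_ , refl)) = x∉ (there (start∈vertices p))

      pathLength : ∀ {u w} → Path T u w → ℕ
      pathLength nil = 0
      pathLength (cons _ p _) = suc (pathLength p)

      vertexAt : ∀ {u w} (p : Path T u w) → Fin (suc (pathLength p)) → V
      vertexAt {u} nil _ = u
      vertexAt (cons {u} _ _ _) fzero = u
      vertexAt (cons _ p _) (fsuc i) = vertexAt p i

      vertexAt-zero : ∀ {u w} (p : Path T u w) → vertexAt p fzero ≡ u
      vertexAt-zero nil = refl
      vertexAt-zero (cons _ _ _) = refl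

      vertexAt-last : ∀ {u w} (p : Path T u w) → vertexAt p (fromℕ (pathLength p)) ≡ w
      vertexAt-last nil = refl
      vertexAt-last (cons _ p _) = vertexAt-last p

      vertexAt-∈ : ∀ {u w} (p : Path T u w) i → vertexAt p i ∈ vertices p
      vertexAt-∈ nil fzero = here refl
      vertexAt-∈ (cons _ _ _) fzero = here refl
      vertexAt-∈ (cons _ p _) (fsuc i) = there (vertexAt-∈ p i)

      vertexAt-injective : ∀ {u w} (p : Path T u w) {i j} → vertexAt p i ≡ vertexAt p j → i ≡ j
      vertexAt-injective nil {fzero} {fzero} _ = refl
      vertexAt-injective (cons _ _ _) {fzero} {fzero} _ = refl
      vertexAt-injective (cons _ p u∉) {fzero} {fsuc j} eq =
        ⊥-elim (u∉ (subst (_∈ vertices p) (≡-sym eq) (vertexAt-∈ p j)))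
      vertexAt-injective (cons _ p u∉) {fsuc i} {fzero} eq =
        ⊥-elim (u∉ (subst (_∈ vertices p) eq (vertexAt-∈ p i)))
      vertexAt-injective (cons _ p _) {fsuc i} {fsuc j} eq = cong fsuc (vertexAt-injective p eq)

      vertexAt-step : ∀ {u w} (p : Path T u w) (i : Fin (pathLength p)) →
        T (vertexAt p (inject₁ i)) (vertexAt p (fsuc i))
      vertexAt-step (cons {u} t p _) fzero = subst (T u) (≡-sym (vertexAt-zero p)) t
      vertexAt-step (cons _ p _) (fsuc i) = vertexAt-step p i

  module _ (H : Graph) where

    chain : ∀ {T : Rel (V H) 0ℓ} m (c : Fin (suc m) → V H) →
      (∀ i → T (c (inject₁ i)) (c (fsuc i))) → Star T (c fzero) (c (fromℕ m))
    chain zero c steps = ε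
    chain (suc m) c steps = steps fzero ◅ chain m (λ i → c (fsuc i)) (λ i → steps (fsuc i))

    allBridges⇒acyclic : ∀ {S : EdgeSet H} → Symmetric S → AllBridges S → ¬ HasCycle H S
    allBridges⇒acyclic sym bridges (k , c , injective , steps , closing) =
      bridges closing (Star-sym (∖-sym sym) (chain (suc (suc k)) c (λ i → keep (steps i) (avoids i))))
      where
      avoids : ∀ i → ¬ SameEdge (c (inject₁ i)) (c (fsuc i)) (c (fromℕ (suc (suc k)))) (c fzero)
      avoids i (inj₁ (eq , _)) = fromℕ≢inject₁ (≡-sym (injective eq))
      avoids i (inj₂ (eq₁ , eq₂)) with injective eq₁ | injective eq₂
      avoids fzero (inj₂ _) | refl | ()
      avoids (fsuc i) (inj₂ _) | () | _

    closedPath⇒cycle : ∀ {T S : EdgeSet H} {a b} (p : Path T a b) → 2 ≤ pathLength p →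
      T ⇒ S → S b a → HasCycle H S
    closedPath⇒cycle {S = S} {a} p@(cons _ (cons _ q _) _) (s≤s (s≤s _)) T⊆S ba =
      pathLength q , vertexAt p , vertexAt-injective p , (λ i → T⊆S (vertexAt-step p i)) ,
      subst (λ z → S z a) (≡-sym (vertexAt-last p)) ba

    record IsSpanningForest (F : EdgeSet H) : Set where
      field
        ⊆edges     : F ⇒ _~_ H
        symmetric  : Symmetric F
        allBridges : AllBridges F
        spanning   : _~_ H ⇒ Star F

  module _ {H G : Graph} (iso : ForestGraphIso H G) where
    open ForestGraphIso iso renaming (to to vertexOf; from to forestAt)

    adjacent⇒agree : ∀ M M′ → ForestAdj H M M′ → ∃[ L ] AgreeOutside L (proj₁ M) (proj₁ M′)
    adjacent⇒agree M _ (u , v , x , y , _ , _ , _ , M′≡) =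
      (u , v) ∷ (x , y) ∷ [] ,
      λ {a} {b} ∉L → mk⇔ (λ m → from (M′≡ a b) (inj₁ (m , λ e → ∉L (here e))))
                         (λ m′ → unchanged (to (M′≡ a b) m′) ∉L)
      where
      unchanged : ∀ {a b} → (proj₁ M a b × ¬ SameEdge a b u v) ⊎ SameEdge a b x y →
        ¬ (a , b) ∈ₑ ((u , v) ∷ (x , y) ∷ []) → proj₁ M a b
      unchanged (inj₁ (m , _)) _ = m
      unchanged (inj₂ e) ∉L = ⊥-elim (∉L (there (here e)))

    ~⇒ForestAdj : ∀ {u v} → _~_ G u v → ForestAdj H (forestAt u) (forestAt v)
    ~⇒ForestAdj {u} {v} uv =
      from (adj (forestAt u) (forestAt v)) (subst₂ (_~_ G) (≡-sym (to-from u)) (≡-sym (to-from v)) uv)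

    reachable⇒agree : ∀ {u w} → Reachable G u w →
      ∃[ L ] AgreeOutside L (proj₁ (forestAt u)) (proj₁ (forestAt w))
    reachable⇒agree here = [] , λ _ → ⇔-refl
    reachable⇒agree (there {u} {v} uv r)
      with L₁ , agree₁ ← adjacent⇒agree (forestAt u) (forestAt v) (~⇒ForestAdj uv)
         | L₂ , agree₂ ← reachable⇒agree r =
      L₁ ++ L₂ , λ ∉L → ⇔-trans (agree₁ (λ i → ∉L (++⁺ˡ i))) (agree₂ (λ i → ∉L (++⁺ʳ L₁ i)))

  allBoolVecs : ∀ n → List (Vec Bool n)
  allBoolVecs zero = [] ∷ []
  allBoolVecs (suc n) = map (true ∷_) (allBoolVecs n) ++ map (false ∷_) (allBoolVecs n)

  ∈-allBoolVecs : ∀ {n} (bs : Vec Bool n) → bs ∈ allBoolVecs n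
  ∈-allBoolVecs [] = here refl
  ∈-allBoolVecs (true ∷ bs) = ∈-++⁺ˡ (∈-map⁺ (true ∷_) (∈-allBoolVecs bs))
  ∈-allBoolVecs {suc n} (false ∷ bs) =
    ∈-++⁺ʳ (map (true ∷_) (allBoolVecs n)) (∈-map⁺ (false ∷_) (∈-allBoolVecs bs))

  does-≡⇒⇔ : ∀ {P Q : Set} (p : Dec P) (q : Dec Q) → does p ≡ does q → P ⇔ Q
  does-≡⇒⇔ (yes p) (yes q) _ = mk⇔ (λ _ → q) (λ _ → p)
  does-≡⇒⇔ (no ¬p) (no ¬q) _ = mk⇔ (λ p → ⊥-elim (¬p p)) (λ q → ⊥-elim (¬q q))

  module Classical (lem : ExcludedMiddle (lsuc 0ℓ)) where

    dec : (P : Set) → Dec P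
    dec P with lem {Lift (lsuc 0ℓ) P}
    ... | yes (lift p) = yes p
    ... | no ¬p = no (λ p → ¬p (lift p))

    module _ {A B : Set} (f : A → B) (f-injective : Injective _≡_ _≡_ f) where

      preimages : List B → List A
      preimages [] = []
      preimages (b ∷ bs) with dec (∃[ a ] f a ≡ b)
      ... | yes (a , _) = a ∷ preimages bs
      ... | no _ = preimages bs

      ∈-preimages : ∀ {a} bs → f a ∈ bs → a ∈ preimages bs
      ∈-preimages {a} (b ∷ bs) (here fa≡b) with dec (∃[ a ] f a ≡ b)
      ... | yes (a′ , fa′≡b) = here (f-injective (≡-trans fa≡b (≡-sym fa′≡b)))
      ... | no none = ⊥-elim (none (a , fa≡b))
      ∈-preimages (b ∷ bs) (there fa∈bs) with dec (∃[ a ] f a ≡ b)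
      ... | yes _ = there (∈-preimages bs fa∈bs)
      ... | no _ = ∈-preimages bs fa∈bs

      enumeration-by-injection : (bs : List B) → (∀ b → b ∈ bs) → Σ (List A) λ as → ∀ a → a ∈ as
      enumeration-by-injection bs ∈bs = preimages bs , λ a → ∈-preimages bs (∈bs (f a))

    module _ {V : Set} {T : Rel V 0ℓ} where

      suffixFrom : ∀ {u v w} (p : Path T v w) → u ∈ vertices p → Path T u w
      suffixFrom nil (here refl) = nil
      suffixFrom p@(cons _ _ _) (here refl) = p
      suffixFrom (cons _ p _) (there u∈p) = suffixFrom p u∈p

      Star⇒Path : ∀ {u w} → Star T u w → Path T u w
      Star⇒Path ε = nil
      Star⇒Path (_◅_ {u} t w) with Star⇒Path w
      ... | p with dec (u ∈ vertices p)
      ... | yes u∈p = suffixFrom p u∈p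
      ... | no u∉p = cons t p u∉p

      ∖∪-split : ∀ {a b} → T ⇒ (T ∖[ a , b ]) ∪[ a , b ]
      ∖∪-split {a} {b} {u} {v} t with dec (SameEdge u v a b)
      ... | yes e = new e
      ... | no n = old (keep t n)

    module _ {V : Set} {S : Rel V 0ℓ} (sym : Symmetric S) where

      AllBridges-∪ : AllBridges S → ∀ {x y} → ¬ Star S x y → AllBridges (S ∪[ x , y ])
      AllBridges-∪ bridges {x} {y} ¬xy {p} {q} pq w with dec (SameEdge p q x y)
      ... | yes pq≡xy = ¬xy (SameEdge-resp (Star-sym sym) (SameEdge-sym pq≡xy) (mapStar unchanged w))
        where
        unchanged : (S ∪[ x , y ]) ∖[ p , q ] ⇒ S
        unchanged (keep (old s) _) = s
        unchanged (keep (new e) n) = ⊥-elim (n (SameEdge-trans e (SameEdge-sym pq≡xy)))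
      ... | no pq≢xy with pq
      ... | new pq≡xy = pq≢xy pq≡xy
      ... | old s =
        ¬xy (mapStar (∖∪-restore sym s) (connects-∪-swap (∖-sym sym) (mapStar ∪∖⊆∖∪ w) (bridges s)))

      -- The first edge of the path outside U works: the rest of the path avoids its first vertex.
      separatingEdge : AllBridges S → ∀ U {x y} → Path S x y → ¬ Star (S ↾ U) x y →
        ∃[ a ] ∃[ b ] S a b × ¬ (a , b) ∈ₑ U × ¬ Star (S ∖[ a , b ]) x y
      separatingEdge bridges U nil ¬U = ⊥-elim (¬U ε)
      separatingEdge bridges U (cons {x} {z} xz p x∉p) ¬U with dec ((x , z) ∈ₑ U)
      ... | no xz∉U = x , z , xz , xz∉U , λ w → bridges xz (w ◅◅ Star-sym (∖-sym sym) (Path-∖ p x∉p))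
      ... | yes xz∈U with separatingEdge bridges U p (λ w → ¬U ((xz , xz∈U) ◅ w))
      ... | a , b , ab , ab∉U , separates =
        a , b , ab , ab∉U ,
        λ w → separates (keep (sym xz) (λ e → ab∉U (∈ₑ-resp (SameEdge-sym e) (∈ₑ-swap xz∈U))) ◅ w)

    module _ (H : Graph) where

      acyclic⇒allBridges : ∀ {S : EdgeSet H} → Symmetric S → S ⇒ _~_ H → ¬ HasCycle H S → AllBridges S
      acyclic⇒allBridges sym S⊆H acyclic ab w with Star⇒Path w
      ... | nil = irrefl H (S⊆H ab)
      ... | cons (keep _ ab≢ab) nil _ = ab≢ab SameEdge-refl
      ... | p@(cons _ (cons _ _ _) _) = acyclic (closedPath⇒cycle H p (s≤s (s≤s z≤n)) kept (sym ab))

      spanning⇒maximal : ∀ {F} → IsSpanningForest H F → IsMaximalForest H F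
      spanning⇒maximal {F} sf =
        (((λ _ _ → ⊆edges) , (λ _ _ → symmetric)) , allBridges⇒acyclic H symmetric allBridges) , maximal
        where
        open IsSpanningForest sf
        maximal : ∀ F′ → IsForest H F′ → _⊆ₑ_ {H} F F′ → _⊆ₑ_ {H} F′ F
        maximal F′ ((F′⊆H , sym′) , acyclic′) F⊆F′ u v uv with dec (F u v)
        ... | yes f = f
        ... | no ¬f = ⊥-elim (acyclic⇒allBridges (sym′ _ _) (F′⊆H _ _) acyclic′ uv
                (mapStar (λ f → keep (F⊆F′ _ _ f) (λ e → ¬f (SameEdge-resp symmetric (SameEdge-sym e) f)))
                         (spanning (F′⊆H u v uv))))

      maximal⇒spanning : ∀ {F} → IsMaximalForest H F → IsSpanningForest H F
      maximal⇒spanning {F} (((F⊆H , sym) , acyclic) , maximal) = record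
        { ⊆edges = F⊆H _ _ ; symmetric = sym _ _ ; allBridges = bridges ; spanning = spanning }
        where
        bridges : AllBridges F
        bridges = acyclic⇒allBridges (sym _ _) (F⊆H _ _) acyclic
        spanning : _~_ H ⇒ Star F
        spanning {x} {y} xy with dec (Star F x y)
        ... | yes w = w
        ... | no ¬w = maximal (F ∪[ x , y ]) extended (λ _ _ → old) x y (new SameEdge-refl) ◅ ε
          where
          extended⊆H : ∀ u v → (F ∪[ x , y ]) u v → _~_ H u v
          extended⊆H u v (old f) = F⊆H u v f
          extended⊆H u v (new e) = SameEdge-resp (Graph.sym H) e xy
          extended : IsForest H (F ∪[ x , y ])
          extended = (extended⊆H , λ _ _ → ∪-sym (sym _ _)) ,
                     allBridges⇒acyclic H (∪-sym (sym _ _)) (AllBridges-∪ (sym _ _) bridges ¬w)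

      exchange : ∀ {F x y a b} → IsSpanningForest H F → _~_ H x y → F a b → ¬ Star (F ∖[ a , b ]) x y →
        IsSpanningForest H ((F ∖[ a , b ]) ∪[ x , y ])
      exchange {F} {x} {y} {a} {b} sf xy ab separates = record
        { ⊆edges = λ { (old (keep f _)) → ⊆edges f ; (new e) → SameEdge-resp (Graph.sym H) e xy }
        ; symmetric = ∪-sym (∖-sym symmetric)
        ; allBridges = AllBridges-∪ (∖-sym symmetric) (AllBridges-⊆ kept allBridges) separates
        ; spanning = λ uv → (reroute ⋆) (spanning uv)
        }
        where
        open IsSpanningForest sf
        a⇝b : Star ((F ∖[ a , b ]) ∪[ x , y ]) a b
        a⇝b = connects-∪-swap (∖-sym symmetric) (mapStar ∖∪-split (spanning xy)) separates
        reroute : F ⇒ Star ((F ∖[ a , b ]) ∪[ x , y ])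
        reroute {s} {t} f with dec (SameEdge s t a b)
        ... | yes e = SameEdge-resp (Star-sym (∪-sym (∖-sym symmetric))) e a⇝b
        ... | no n = old (keep f n) ◅ ε

      spanningForests-agree : ∀ {F M U} → IsSpanningForest H F → IsSpanningForest H M →
        (∀ {x y} → _~_ H x y → ¬ F x y → Star (F ↾ U) x y) → AgreeOutside (pairsOn U) M F
      spanningForests-agree {F} {M} {U} sfF sfM U-connects {a} {b} ∉pairs = mk⇔ M⇒F F⇒M
        where
        module F = IsSpanningForest sfF
        module M = IsSpanningForest sfM
        M⇒F : M a b → F a b
        M⇒F m with dec (F a b)
        ... | yes f = f
        ... | no ¬f = ⊥-elim (∉pairs (∈endpoints⇒∈ₑpairsOn (Star-↾⇒∈endpoints w a≢b)
                                        (Star-↾⇒∈endpoints (Star-sym (↾-sym F.symmetric) w) (λ eq → a≢b (≡-sym eq)))))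
          where
          w : Star (F ↾ U) a b
          w = U-connects (M.⊆edges m) ¬f
          a≢b : ¬ a ≡ b
          a≢b refl = irrefl H (M.⊆edges m)
        F⇒M : F a b → M a b
        F⇒M f with dec (M a b)
        ... | yes m = m
        ... | no ¬m = ⊥-elim (F.allBridges f ((avoid ⋆) (M.spanning (F.⊆edges f))))
          where
          avoid : M ⇒ Star (F ∖[ a , b ])
          avoid {s} {t} m with dec (F s t)
          ... | yes f′ = keep f′ (λ e → ¬m (SameEdge-resp M.symmetric (SameEdge-sym e) m)) ◅ ε
          ... | no ¬f′ =
            mapStar (λ (f′ , i) → keep f′ λ e → ∉pairs (∈ₑ⇒∈ₑpairsOn U (∈ₑ-resp (SameEdge-sym e) i)))
                    (U-connects (M.⊆edges m) ¬f′)

    module _ {H G : Graph} (iso : ForestGraphIso H G) where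
      open ForestGraphIso iso renaming (to to vertexOf; from to forestAt)

      -- A vertex of G is determined by which pairs of W its forest contains.
      forestsAgreeOutside⇒finite : ∀ W → (∀ M M′ → AgreeOutside W (proj₁ M) (proj₁ M′)) →
        Σ (List (V G)) λ vs → ∀ v → v ∈ vs
      forestsAgreeOutside⇒finite W agree =
        enumeration-by-injection code code-injective (allBoolVecs (length W)) ∈-allBoolVecs
        where
        _∈forestAt_ : V H × V H → V G → Set
        (p , q) ∈forestAt v = proj₁ (forestAt v) p q
        code : V G → Vec Bool (length W)
        code v = tabulate (λ i → does (dec (lookup W i ∈forestAt v)))
        code-injective : Injective _≡_ _≡_ code
        code-injective {v} {v′} same = begin
          v                        ≡⟨ to-from v ⟨
          vertexOf (forestAt v)    ≡⟨ to-cong {forestAt v} {forestAt v′} (λ a b → sameForest) ⟩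
          vertexOf (forestAt v′)   ≡⟨ to-from v′ ⟩
          v′                       ∎
          where
          open ≡-Reasoning
          module M  = IsSpanningForest (maximal⇒spanning H (proj₂ (forestAt v)))
          module M′ = IsSpanningForest (maximal⇒spanning H (proj₂ (forestAt v′)))
          sameForest : ∀ {a b} → (a , b) ∈forestAt v ⇔ (a , b) ∈forestAt v′
          sameForest {a} {b} with dec ((a , b) ∈ₑ W)
          ... | no ∉W = agree (forestAt v) (forestAt v′) ∉W
          ... | yes ∈W =
            mk⇔ (λ m → SameEdge-resp M′.symmetric e (to atIndex (SameEdge-resp M.symmetric (SameEdge-sym e) m)))
                (λ m → SameEdge-resp M.symmetric e (from atIndex (SameEdge-resp M′.symmetric (SameEdge-sym e) m)))
            where
            i = index ∈W
            e = lookup-result ∈W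
            atIndex : lookup W i ∈forestAt v ⇔ lookup W i ∈forestAt v′
            atIndex = does-≡⇒⇔ (dec _) (dec _) (begin
              does (dec (lookup W i ∈forestAt v))   ≡⟨ lookup∘tabulate _ i ⟨
              Vec.lookup (code v) i                 ≡⟨ cong (λ c → Vec.lookup c i) same ⟩
              Vec.lookup (code v′) i                ≡⟨ lookup∘tabulate _ i ⟩
              does (dec (lookup W i ∈forestAt v′))  ∎)

    module Construction {H G : Graph} (iso : ForestGraphIso H G) (infinite : IsInfinite G) where
      open ForestGraphIso iso renaming (to to vertexOf; from to forestAt)

      v₀ : V G
      v₀ with dec (V G)
      ... | yes v = v
      ... | no ¬v = ⊥-elim (infinite ([] , λ v → ⊥-elim (¬v v)))

      F₀ : EdgeSet H
      F₀ = proj₁ (forestAt v₀)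

      -- F ↾ U already connects the endpoints of every edge of H in U, and later exchanges only
      -- touch edges outside U, so F never changes on U again.
      record Stage : Set₁ where
        field
          F              : EdgeSet H
          U              : List (V H × V H)
          spanningForest : IsSpanningForest H F
          U-connected    : ∀ {a b} → (a , b) ∈ₑ U → _~_ H a b → ¬ F a b → Star (F ↾ U) a b
          agrees         : AgreeOutside U F F₀

      record Move (s : Stage) : Set where
        open Stage s
        field
          x y       : V H
          xy        : _~_ H x y
          xy∉F      : ¬ F x y
          ¬U-xy     : ¬ Star (F ↾ U) x y
          a b       : V H
          ab∈F      : F a b
          ab∉U      : ¬ (a , b) ∈ₑ U
          separates : ¬ Star (F ∖[ a , b ]) x y

      module _ (s : Stage) where
        open Stage s
        open IsSpanningForest spanningForest

        -- Otherwise every maximal forest agrees with F outside pairsOn U, so G would be finite.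
        unconnectedEdge : ∃[ x ] ∃[ y ] _~_ H x y × ¬ F x y × ¬ Star (F ↾ U) x y
        unconnectedEdge with dec (∃[ x ] ∃[ y ] _~_ H x y × ¬ F x y × ¬ Star (F ↾ U) x y)
        ... | yes e = e
        ... | no ¬e = ⊥-elim (infinite (forestsAgreeOutside⇒finite iso (pairsOn U) agree))
          where
          U-connects : ∀ {x y} → _~_ H x y → ¬ F x y → Star (F ↾ U) x y
          U-connects {x} {y} xy ¬f with dec (Star (F ↾ U) x y)
          ... | yes w = w
          ... | no ¬w = ⊥-elim (¬e (x , y , xy , ¬f , ¬w))
          agreesWithF : ∀ M → AgreeOutside (pairsOn U) (proj₁ M) F
          agreesWithF (_ , maximal) = spanningForests-agree H spanningForest (maximal⇒spanning H maximal) U-connects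
          agree : ∀ M M′ → AgreeOutside (pairsOn U) (proj₁ M) (proj₁ M′)
          agree M M′ ∉ = ⇔-trans (agreesWithF M ∉) (⇔-sym (agreesWithF M′ ∉))

        move : Move s
        move with unconnectedEdge
        ... | x , y , xy , xy∉F , ¬U-xy
          with a , b , ab∈F , ab∉U , separates ←
            separatingEdge symmetric allBridges U (Star⇒Path (spanning xy)) ¬U-xy
          = record { x = x ; y = y ; xy = xy ; xy∉F = xy∉F ; ¬U-xy = ¬U-xy
                   ; a = a ; b = b ; ab∈F = ab∈F ; ab∉U = ab∉U ; separates = separates }

      module Step (s : Stage) where
        open Stage s
        open Move (move s)

        F′ : EdgeSet H
        F′ = (F ∖[ a , b ]) ∪[ x , y ]

        spanningForest′ : IsSpanningForest H F′
        spanningForest′ = exchange H spanningForest xy ab∈F separates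

        open IsSpanningForest spanningForest′ using () renaming (symmetric to symmetric′; spanning to spanning′)

        a⇝b : Star F′ a b
        a⇝b = spanning′ (IsSpanningForest.⊆edges spanningForest ab∈F)

        U′ : List (V H × V H)
        U′ = (a , b) ∷ (x , y) ∷ edgesOf a⇝b ++ U

        xy∉U : ¬ (x , y) ∈ₑ U
        xy∉U i = ¬U-xy (U-connected i xy xy∉F)

        U⊆U′ : ∀ {p q} → (p , q) ∈ₑ U → (p , q) ∈ₑ U′
        U⊆U′ i = there (there (++⁺ʳ (edgesOf a⇝b) i))

        F′⇔F-on-U : ∀ {p q} → (p , q) ∈ₑ U → F′ p q ⇔ F p q
        F′⇔F-on-U {p} {q} i = mk⇔ unchanged (λ f → old (keep f (λ e → ab∉U (∈ₑ-resp (SameEdge-sym e) i))))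
          where
          unchanged : F′ p q → F p q
          unchanged (old (keep f _)) = f
          unchanged (new e) = ⊥-elim (xy∉U (∈ₑ-resp (SameEdge-sym e) i))

        U′-connected : ∀ {p q} → (p , q) ∈ₑ U′ → _~_ H p q → ¬ F′ p q → Star (F′ ↾ U′) p q
        U′-connected (here e) _ _ =
          SameEdge-resp (Star-sym (↾-sym symmetric′)) e
            (mapStar (λ (f , i) → f , there (there (++⁺ˡ i))) (Star-↾-edgesOf a⇝b))
        U′-connected (there (here e)) _ ¬f = ⊥-elim (¬f (new e))
        U′-connected (there (there i)) pq ¬f with ++⁻ (edgesOf a⇝b) i
        ... | inj₁ i′ = ⊥-elim (¬f (∈-edgesOf symmetric′ a⇝b i′))
        ... | inj₂ i′ = mapStar (λ (f , j) → from (F′⇔F-on-U j) f , U⊆U′ j)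
                                (U-connected i′ pq (λ f → ¬f (from (F′⇔F-on-U i′) f)))

        agrees′ : AgreeOutside U′ F′ F₀
        agrees′ {p} {q} ∉U′ = ⇔-trans (mk⇔ unchanged (λ f → old (keep f (λ e → ∉U′ (here e)))))
                                      (agrees (λ i → ∉U′ (U⊆U′ i)))
          where
          unchanged : F′ p q → F p q
          unchanged (old (keep f _)) = f
          unchanged (new e) = ⊥-elim (∉U′ (there (here e)))

        next : Stage
        next = record
          { F = F′ ; U = U′ ; spanningForest = spanningForest′ ; U-connected = U′-connected ; agrees = agrees′ }

      stage : ℕ → Stage
      stage zero = record
        { F = F₀ ; U = [] ; spanningForest = maximal⇒spanning H (proj₂ (forestAt v₀))
        ; U-connected = λ () ; agrees = λ _ → ⇔-refl }
      stage (suc n) = Step.next (stage n)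

      Fₙ : ℕ → EdgeSet H
      Fₙ n = Stage.F (stage n)

      Uₙ : ℕ → List (V H × V H)
      Uₙ n = Stage.U (stage n)

      module SFₙ (n : ℕ) = IsSpanningForest (Stage.spanningForest (stage n))

      frozen : ∀ {n m p q} → n ≤′ m → (p , q) ∈ₑ Uₙ n → (Fₙ m p q ⇔ Fₙ n p q) × (p , q) ∈ₑ Uₙ m
      frozen ≤′-refl i = ⇔-refl , i
      frozen (≤′-step {m} n≤m) i with same , i′ ← frozen n≤m i =
        ⇔-trans (Step.F′⇔F-on-U (stage m) i′) same , Step.U⊆U′ (stage m) i′

      F∞ : EdgeSet H
      F∞ p q = ∃[ n ] ∀ m → n ≤ m → Fₙ m p q

      F∞-frozen : ∀ n {p q} → (p , q) ∈ₑ Uₙ n → Fₙ n p q → F∞ p q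
      F∞-frozen n i f = n , λ m n≤m → from (proj₁ (frozen (≤⇒≤′ n≤m) i)) f

      Star-F∞-eventually : ∀ {a b p q} → Star (F∞ ∖[ a , b ]) p q →
        ∃[ N ] ∀ m → N ≤ m → Star (Fₙ m ∖[ a , b ]) p q
      Star-F∞-eventually ε = 0 , λ _ _ → ε
      Star-F∞-eventually (keep (n , always) n≢ ◅ w) with N , always′ ← Star-F∞-eventually w =
        n ⊔ N , λ m le → keep (always m (≤-trans (m≤m⊔n n N) le)) n≢ ◅ always′ m (≤-trans (m≤n⊔m n N) le)

      F₀⇒Star-F∞ : F₀ ⇒ Star F∞
      F₀⇒Star-F∞ {p} {q} f with dec (∃[ n ] (p , q) ∈ₑ Uₙ n)
      ... | no never = (0 , λ m _ → from (Stage.agrees (stage m) (λ i → never (m , i))) f) ◅ ε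
      ... | yes (n , i) with dec (Fₙ n p q)
      ...   | yes fₙ = F∞-frozen n i fₙ ◅ ε
      ...   | no ¬fₙ =
        mapStar (λ (fₙ , j) → F∞-frozen n j fₙ) (Stage.U-connected (stage n) i (SFₙ.⊆edges 0 f) ¬fₙ)

      spanningF∞ : IsSpanningForest H F∞
      spanningF∞ = record
        { ⊆edges     = λ (n , always) → SFₙ.⊆edges n (always n ≤-refl)
        ; symmetric  = λ (n , always) → n , λ m le → SFₙ.symmetric m (always m le)
        ; allBridges = λ (n , always) w → let N , always′ = Star-F∞-eventually w in
                         SFₙ.allBridges (n ⊔ N) (always _ (m≤m⊔n n N)) (always′ _ (m≤n⊔m n N))
        ; spanning   = λ pq → (F₀⇒Star-F∞ ⋆) (SFₙ.spanning 0 pq)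
        }

      M∞ : MaximalForest H
      M∞ = F∞ , spanning⇒maximal H spanningF∞

      module Moveₙ (n : ℕ) = Move (move (stage n))
      open Moveₙ using (x; y)

      move∈Uₙ₊₁ : ∀ n → (x n , y n) ∈ₑ Uₙ (suc n)
      move∈Uₙ₊₁ n = there (here SameEdge-refl)

      moves-distinct : ∀ {n m} → n < m → ¬ SameEdge (x m) (y m) (x n) (y n)
      moves-distinct {n} {m} n<m e =
        Step.xy∉U (stage m) (∈ₑ-resp e (proj₂ (frozen (≤⇒≤′ n<m) (move∈Uₙ₊₁ n))))

      move∈F∞ : ∀ n → F∞ (x n) (y n)
      move∈F∞ n = F∞-frozen (suc n) (move∈Uₙ₊₁ n) (new SameEdge-refl)

      move∉F₀ : ∀ n → ¬ F₀ (x n) (y n)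
      move∉F₀ n f = Moveₙ.xy∉F n (from (Stage.agrees (stage n) (Step.xy∉U (stage n))) f)

      moves∈ : ∀ {L} → AgreeOutside L F₀ (proj₁ (forestAt (vertexOf M∞))) → ∀ n → (x n , y n) ∈ₑ L
      moves∈ {L} agree n with dec ((x n , y n) ∈ₑ L)
      ... | yes i = i
      ... | no ∉L = ⊥-elim (move∉F₀ n (from (agree ∉L) (from (from-to M∞ _ _) (move∈F∞ n))))

      disconnected : ¬ IsConnected G
      disconnected connected with L , agree ← reachable⇒agree iso (connected v₀ (vertexOf M∞)) =
        distinctEdges-∉-finite x y moves-distinct L (moves∈ agree)

open import Level using (suc; zero)
open import Data.Product using (Σ; _,_)
open import Axiom.ExcludedMiddle using (ExcludedMiddle)
open import Relation.Nullary using (¬_)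

theorem4p2 : ExcludedMiddle (suc zero) →
    (G : Graph) → IsInfinite G → IsConnected G →
    ¬ (Σ Graph λ H → ForestGraphIso H G)
theorem4p2 lem G infinite connected (H , iso) = Classical.Construction.disconnected lem iso infinite connected
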